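{- For every $k\ge 0$, $W^{\mathcal{A}}_{\alpha\tau_{k+1}} \le \beta\, W^{\mathcal{OPT}}_{\tau_k}$.
   Context: Fix a scheduling environment with a set $J$ of jobs; each job $j$ has weight $w_j\ge0$ and release time $r_j\ge0$, and no part of $j$ may be processed before $r_j$. Standing assumption: all processing times are at least $1$. Online, job $j$ becomes known at $r_j$. MUWP: given jobs with weights and a deadline $D$, find a subset $S$ that can be completed by time $D$ minimizing the total weight of jobs not in $S$. An $(\alpha,\beta)$-approximation for the MUWP finds a subset that can be completed by $\alpha D$ with unscheduled weight at most $\beta$ times the minimum unscheduled weight for deadline $D$. A $\gamma$-approximation for the offline problem with identical release times outputs, for jobs all available at time $0$, a schedule of total weighted completion time at most $\gamma$ times optimal, and (by assumption) does not increase the makespan, so a set returned by the $(\alpha,\beta)$-approximation with deadline $D$ is scheduled within length $\alpha D$. Algorithm $\mathcal{A}$: $\tau_0=0$, $\tau_k=2^{k-1}$ for $k\ge1$. At each $\tau_k$, let $R(\tau_k)$ be the set of jobs released but not yet scheduled by $\mathcal{A}$ before $\tau_k$; run the $(\alpha,\beta)$-approximation on $R(\tau_k)$ with deadline $D=\tau_{k+1}-\tau_k$, obtaining $S_k$, and schedule $S_k$ in $[\alpha\tau_k,\alpha\tau_{k+1})$, starting at $\alpha\tau_k$, using the $\gamma$-approximation. For a schedule $X$ and time $\tau$, $W^X_\tau$ denotes the total weight of jobs that complete after time $\tau$ in $X$ (including jobs not yet released at $\tau$). $\mathcal{OPT}$ denotes an optimal offline schedule (respecting release times) minimizing $\sum_j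 w_jC_j$.
   Formalization: The weights $w_j$, the release times $r_j$, the completion times of all schedules and the factors α and β are rational. -}

module Defs where

open import Data.Nat as ℕ using (ℕ; zero; suc)
open import Data.Integer using (+_)
open import Data.Fin using (Fin)
open import Data.Fin.Subset using (Subset; _∈_; _∉_; _⊆_; _∪_; _∩_; ∁; ⊥; inside; outside)
open import Data.Fin.Subset.Properties using (_∈?_)
open import Data.Vec using (tabulate)
open import Data.Bool using (Bool; true; false; if_then_else_; _∧_; not)
open import Data.Rational using (ℚ; 0ℚ; 1ℚ; _+_; _*_; _-_; _≤_; _<_; _/_)
open import Data.Rational.Properties using (_≤?_; _<?_)
open import Data.Maybe using (Maybe; just; nothing)
open import Data.Product using (Σ; _×_; ∃)
open import Relation.Nullary.Decidable using (does)
open import Relation.Binary.PropositionalEquality using (_≡_)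

sumℚ : ∀ {n} → (Fin n → ℚ) → ℚ
sumℚ {zero}  f = 0ℚ
sumℚ {suc n} f = f Fin.zero + sumℚ (λ i → f (Fin.suc i))

wt : ∀ {n} → (Fin n → ℚ) → Subset n → ℚ
wt w S = sumℚ (λ j → if does (j ∈? S) then w j else 0ℚ)

_∖_ : ∀ {n} → Subset n → Subset n → Subset n
R ∖ S = R ∩ ∁ S

completedBy : ∀ {n} → (Fin n → ℚ) → ℚ → Subset n
completedBy C t = tabulate (λ j → if does (C j ≤? t) then inside else outside)

-- Completion "after time τ": nothing = the job never completes.
completesAfter : Maybe ℚ → ℚ → Bool
completesAfter nothing  τ = true
completesAfter (just c) τ = does (τ <? c)

Wt : ∀ {n} → (Fin n → ℚ) → (Fin n → Maybe ℚ) → ℚ → ℚ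
Wt w C τ = sumℚ (λ j → if completesAfter (C j) τ then w j else 0ℚ)

τ : ℕ → ℚ
τ zero    = 0ℚ
τ (suc k) = (+ (2 ℕ.^ k)) / 1

record Env (n : ℕ) (r : Fin n → ℚ) : Set₁ where
  field
    -- feasible schedules of all jobs respecting release times
    Schedule    : Set
    C           : Schedule → Fin n → ℚ
    -- CanComplete S D : the jobs of S, all available at time 0,
    -- can be completed by time D.
    CanComplete : Subset n → ℚ → Set
    -- processing times are at least 1 (no job completes before r_j + 1)
    proc≥1          : ∀ σ j → r j + 1ℚ ≤ C σ j
    prefix-feasible : ∀ σ t → 0ℚ ≤ t → CanComplete (completedBy (C σ) t) t
    subset-closed   : ∀ {S T D} → S ⊆ T → CanComplete T D → CanComplete S D
    deadline-mono   : ∀ {S D D′} → D ≤ D′ → CanComplete S D → CanComplete S D′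

module _ {n : ℕ} {r : Fin n → ℚ} (E : Env n r) where
  open Env E

  IsOptimal : (Fin n → ℚ) → Schedule → Set
  IsOptimal w opt = ∀ σ → sumℚ (λ j → w j * C opt j) ≤ sumℚ (λ j → w j * C σ j)

  IsMUWPApprox : (Fin n → ℚ) → ℚ → ℚ → (Subset n → ℚ → Subset n) → Set
  IsMUWPApprox w α β apx = ∀ R D → 0ℚ < D →
      (apx R D ⊆ R)
    × CanComplete (apx R D) (α * D)
    × (∀ T → T ⊆ R → CanComplete T D → wt w (R ∖ apx R D) ≤ β * wt w (R ∖ T))

module Alg {n : ℕ} (r : Fin n → ℚ) (apx : Subset n → ℚ → Subset n) where

  Rel : Subset n → ℚ → Subset n
  Rel Done t = tabulate (λ j → if does (r j ≤? t) then inside else outside) ∖ Done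

  Dl : ℕ → ℚ
  Dl k = τ (suc k) - τ k

  Done : ℕ → Subset n
  Done zero    = ⊥
  Done (suc k) = Done k ∪ apx (Rel (Done k) (τ k)) (Dl k)

  R : ℕ → Subset n
  R k = Rel (Done k) (τ k)

  S : ℕ → Subset n
  S k = apx (R k) (Dl k)

  -- CA is a schedule produced by A: every job of S_k completes by α τ_{k+1}
  -- (S_k is scheduled in [α τ_k, α τ_{k+1})), and jobs never selected
  -- never complete.
  IsAlgSchedule : ℚ → (Fin n → Maybe ℚ) → Set
  IsAlgSchedule α CA =
      (∀ k j → j ∈ S k → ∃ λ c → (CA j ≡ just c) × (c ≤ α * τ (suc k)))
    × (∀ j → (∀ k → j ∉ S k) → CA j ≡ nothing)

module Submission where

-- Fix k, write R = R(τ_k), S = S_k, and let earlyIn σ ⊆ R be the jobs of R that σ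
-- completes by τ_k. Let U be the weight of the jobs released after τ_k.
--  * A job still running in A after α τ_{k+1} was not selected in phases
--    0..k (those finish by α τ_m ≤ α τ_{k+1}), so it lies in R ∖ S or is
--    released after τ_k; hence W^A_{α τ_{k+1}} ≤ wt(R ∖ S) + U.
--  * earlyIn σ can be completed by τ_k ≤ D_k = τ_{k+1} − τ_k, so the MUWP guarantee
--    gives wt(R ∖ S) ≤ β · wt(R ∖ earlyIn σ).
--  * Jobs of R ∖ earlyIn σ and jobs released after τ_k form disjoint sets of jobs
--    that σ completes after τ_k (processing times are ≥ 1), hence
--    wt(R ∖ earlyIn σ) + U ≤ W^σ_{τ_k}; with β ≥ 1 the claim follows.

open import Defs
open import Data.Nat using (ℕ; suc)
open import Data.Fin using (Fin)
open import Data.Fin.Subset using (Subset)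
open import Data.Rational using (ℚ; 0ℚ; 1ℚ; _*_; _≤_)
open import Data.Maybe using (Maybe; just)

open import Data.Nat as ℕ using (zero; _^_; _≤′_; ≤′-refl; ≤′-step)
import Data.Nat.Properties as ℕP
open import Data.Integer as ℤ using (+_)
import Data.Integer.Properties as ℤP
open import Data.Rational using (_+_; _-_; _<_; _/_; toℚᵘ; -_; nonNegative)
import Data.Rational.Properties as QP
open import Data.Rational.Unnormalised as U using (mkℚᵘ; *≡*)
import Data.Rational.Unnormalised.Properties as UP
open import Data.Fin.Subset using (_∈_; _∉_; _⊆_; _∩_; ∁; inside; outside)
open import Data.Fin.Subset.Properties
  using (_∈?_; ∉⊥; x∈p∩q⁺; x∈p∩q⁻; x∈p∪q⁺; x∈p∪q⁻; x∉p⇒x∈∁p; x∈∁p⇒x∉p)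
open import Data.Vec using (tabulate)
open import Data.Vec.Properties using (lookup∘tabulate; lookup⇒[]=; []=⇒lookup)
open import Data.Bool using (Bool; true; false; if_then_else_; T)
open import Data.Unit using (tt)
open import Data.Product using (_×_; _,_; proj₁; proj₂; ∃)
open import Data.Sum using (_⊎_; inj₁; inj₂)
open import Data.Empty using (⊥; ⊥-elim)
open import Relation.Nullary using (Dec; yes; no; ¬_)
open import Relation.Nullary.Decidable using (does; dec-true)
open import Relation.Binary.PropositionalEquality

+-homo-/1 : ∀ a b → (+ (a ℕ.+ b)) / 1 ≡ (+ a) / 1 + (+ b) / 1
+-homo-/1 a b = QP.toℚᵘ-injective (begin
  toℚᵘ ((+ (a ℕ.+ b)) / 1)              ≈⟨ embed (a ℕ.+ b) ⟩
  mkℚᵘ (+ (a ℕ.+ b)) 0                  ≈⟨ *≡* numerators ⟩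
  mkℚᵘ (+ a) 0 U.+ mkℚᵘ (+ b) 0         ≈⟨ UP.+-cong (UP.≃-sym (embed a)) (UP.≃-sym (embed b)) ⟩
  toℚᵘ ((+ a) / 1) U.+ toℚᵘ ((+ b) / 1) ≈⟨ UP.≃-sym (QP.toℚᵘ-homo-+ ((+ a) / 1) ((+ b) / 1)) ⟩
  toℚᵘ ((+ a) / 1 + (+ b) / 1)          ∎)
  where
  open UP.≃-Reasoning
  embed : ∀ c → toℚᵘ ((+ c) / 1) U.≃ mkℚᵘ (+ c) 0
  embed c = QP.toℚᵘ-fromℚᵘ (mkℚᵘ (+ c) 0)
  numerators : + (a ℕ.+ b) ℤ.* + 1 ≡ (+ a ℤ.* + 1 ℤ.+ + b ℤ.* + 1) ℤ.* + 1
  numerators = trans (ℤP.*-identityʳ (+ (a ℕ.+ b)))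
    (trans (ℤP.pos-+ a b)
      (sym (trans (ℤP.*-identityʳ _) (cong₂ ℤ._+_ (ℤP.*-identityʳ (+ a)) (ℤP.*-identityʳ (+ b))))))

τ-double : ∀ m → τ (suc (suc m)) ≡ τ (suc m) + τ (suc m)
τ-double m = trans (cong (λ x → (+ (N ℕ.+ x)) / 1) (ℕP.+-identityʳ N)) (+-homo-/1 N N)
  where
  N : ℕ
  N = 2 ^ m

τ-nonneg : ∀ k → 0ℚ ≤ τ k
τ-nonneg zero    = QP.≤-refl
τ-nonneg (suc m) = QP.nonNegative⁻¹ (τ (suc m)) {{QP.normalize-nonNeg (2 ^ m) 1}}

τ-pos : ∀ m → 0ℚ < τ (suc m)
τ-pos m = QP.positive⁻¹ (τ (suc m)) {{QP.normalize-pos (2 ^ m) 1 {{_}} {{ℕP.m^n≢0 2 m}}}}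

τ-step : ∀ k → τ k ≤ τ (suc k)
τ-step zero    = τ-nonneg 1
τ-step (suc m) = begin
  a         ≡⟨ QP.+-identityʳ a ⟨
  a + 0ℚ    ≤⟨ QP.+-monoʳ-≤ a (τ-nonneg (suc m)) ⟩
  a + a     ≡⟨ τ-double m ⟨
  τ (suc (suc m)) ∎
  where
  open QP.≤-Reasoning
  a : ℚ
  a = τ (suc m)

τ-mono : ∀ {m k} → m ℕ.≤ k → τ m ≤ τ k
τ-mono m≤k = go (ℕP.≤⇒≤′ m≤k)
  where
  go : ∀ {m k} → m ≤′ k → τ m ≤ τ k
  go ≤′-refl         = QP.≤-refl
  go (≤′-step {k} p) = QP.≤-trans (go p) (τ-step k)

phase-length : ∀ m → τ (suc (suc m)) - τ (suc m) ≡ τ (suc m)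
phase-length m = begin
  τ (suc (suc m)) - a ≡⟨ cong (_- a) (τ-double m) ⟩
  (a + a) + - a       ≡⟨ QP.+-assoc a a (- a) ⟩
  a + (a + - a)       ≡⟨ cong (_+_ a) (QP.+-inverseʳ a) ⟩
  a + 0ℚ              ≡⟨ QP.+-identityʳ a ⟩
  a                   ∎
  where
  open ≡-Reasoning
  a : ℚ
  a = τ (suc m)

phase-pos : ∀ k → 0ℚ < τ (suc k) - τ k
phase-pos zero    = τ-pos 0
phase-pos (suc m) = subst (0ℚ <_) (sym (phase-length m)) (τ-pos m)

τ≤phase : ∀ k → τ k ≤ τ (suc k) - τ k
τ≤phase zero    = τ-nonneg 1
τ≤phase (suc m) = QP.≤-reflexive (sym (phase-length m))

sum-mono : ∀ {n} {f g : Fin n → ℚ} → (∀ j → f j ≤ g j) → sumℚ f ≤ sumℚ g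
sum-mono {zero}  f≤g = QP.≤-refl
sum-mono {suc n} f≤g = QP.+-mono-≤ (f≤g Fin.zero) (sum-mono (λ j → f≤g (Fin.suc j)))

sum-nonneg : ∀ {n} {f : Fin n → ℚ} → (∀ j → 0ℚ ≤ f j) → 0ℚ ≤ sumℚ f
sum-nonneg {zero}  f≥0 = QP.≤-refl
sum-nonneg {suc n} f≥0 = QP.+-mono-≤ (f≥0 Fin.zero) (sum-nonneg (λ j → f≥0 (Fin.suc j)))

sum-+ : ∀ {n} (f g : Fin n → ℚ) → sumℚ (λ j → f j + g j) ≡ sumℚ f + sumℚ g
sum-+ {zero}  f g = refl
sum-+ {suc n} f g = begin
  (f₀ + g₀) + sumℚ (λ j → f (Fin.suc j) + g (Fin.suc j))
    ≡⟨ cong (_+_ (f₀ + g₀)) (sum-+ (λ j → f (Fin.suc j)) (λ j → g (Fin.suc j))) ⟩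
  (f₀ + g₀) + (Σf + Σg)  ≡⟨ QP.+-assoc f₀ g₀ (Σf + Σg) ⟩
  f₀ + (g₀ + (Σf + Σg))  ≡⟨ cong (_+_ f₀) (QP.+-assoc g₀ Σf Σg) ⟨
  f₀ + ((g₀ + Σf) + Σg)  ≡⟨ cong (λ x → f₀ + (x + Σg)) (QP.+-comm g₀ Σf) ⟩
  f₀ + ((Σf + g₀) + Σg)  ≡⟨ cong (_+_ f₀) (QP.+-assoc Σf g₀ Σg) ⟩
  f₀ + (Σf + (g₀ + Σg))  ≡⟨ QP.+-assoc f₀ Σf (g₀ + Σg) ⟨
  (f₀ + Σf) + (g₀ + Σg)  ∎
  where
  open ≡-Reasoning
  f₀ g₀ Σf Σg : ℚ
  f₀ = f Fin.zero
  g₀ = g Fin.zero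
  Σf = sumℚ (λ j → f (Fin.suc j))
  Σg = sumℚ (λ j → g (Fin.suc j))

≥1⇒nonneg : ∀ {x} → 1ℚ ≤ x → 0ℚ ≤ x
≥1⇒nonneg = QP.≤-trans (QP.<⇒≤ (QP.positive⁻¹ 1ℚ))

absorb : ∀ {x y u β} → 1ℚ ≤ β → 0ℚ ≤ u → x ≤ β * y → x + u ≤ β * (y + u)
absorb {x} {y} {u} {β} 1≤β u≥0 x≤βy = begin
  x + u           ≤⟨ QP.+-mono-≤ x≤βy u≤βu ⟩
  β * y + β * u   ≡⟨ QP.*-distribˡ-+ β y u ⟨
  β * (y + u)     ∎
  where
  open QP.≤-Reasoning
  u≤βu : u ≤ β * u
  u≤βu = begin
    u        ≡⟨ QP.*-identityˡ u ⟨
    1ℚ * u   ≤⟨ QP.*-monoʳ-≤-nonNeg u {{nonNegative u≥0}} 1≤β ⟩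
    β * u    ∎

ind : Bool → ℚ → ℚ
ind b x = if b then x else 0ℚ

ind-nonneg : ∀ b {x} → 0ℚ ≤ x → 0ℚ ≤ ind b x
ind-nonneg true  x≥0 = x≥0
ind-nonneg false x≥0 = QP.≤-refl

ind-cover : ∀ a b c {x} → 0ℚ ≤ x → (T a → T b ⊎ T c) → ind a x ≤ ind b x + ind c x
ind-cover false b     c     x≥0 _ = QP.+-mono-≤ (ind-nonneg b x≥0) (ind-nonneg c x≥0)
ind-cover true  true  c {x} x≥0 _ =
  QP.≤-trans (QP.≤-reflexive (sym (QP.+-identityʳ x))) (QP.+-monoʳ-≤ x (ind-nonneg c x≥0))
ind-cover true  false true  {x} _ _ = QP.≤-reflexive (sym (QP.+-identityˡ x))
ind-cover true  false false _ a⇒b∨c with a⇒b∨c tt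
... | inj₁ ()
... | inj₂ ()

ind-disjoint : ∀ a b c {x} → 0ℚ ≤ x → (T b → T a) → (T c → T a) → (T b → T c → ⊥)
             → ind b x + ind c x ≤ ind a x
ind-disjoint a     true  true  _   _   _   disj = ⊥-elim (disj tt tt)
ind-disjoint true  true  false {x} _ _ _ _ = QP.≤-reflexive (QP.+-identityʳ x)
ind-disjoint false true  false _   b⇒a _ _ = ⊥-elim (b⇒a tt)
ind-disjoint true  false true  {x} _ _ _ _ = QP.≤-reflexive (QP.+-identityˡ x)
ind-disjoint false false true  _   _ c⇒a _ = ⊥-elim (c⇒a tt)
ind-disjoint a     false false x≥0 _ _ _ = ind-nonneg a x≥0

T-does⁻ : ∀ {P : Set} (P? : Dec P) → T (does P?) → P
T-does⁻ (yes p) _ = p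

T-does⁺ : ∀ {P : Set} (P? : Dec P) → P → T (does P?)
T-does⁺ (yes _) _ = tt
T-does⁺ (no ¬p) p = ¬p p

∈-select⁺ : ∀ {n} {P : Fin n → Set} (P? : ∀ i → Dec (P i)) {j} → P j
          → j ∈ tabulate (λ i → if does (P? i) then inside else outside)
∈-select⁺ P? {j} p = lookup⇒[]= j _
  (trans (lookup∘tabulate _ j) (cong (λ b → if b then inside else outside) (dec-true (P? j) p)))

∈-select⁻ : ∀ {n} {P : Fin n → Set} (P? : ∀ i → Dec (P i)) {j}
          → j ∈ tabulate (λ i → if does (P? i) then inside else outside) → P j
∈-select⁻ P? {j} j∈ = selected (P? j) (trans (sym (lookup∘tabulate _ j)) ([]=⇒lookup j∈))
  where
  selected : ∀ {Q : Set} (Q? : Dec Q) → (if does Q? then inside else outside) ≡ inside → Q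
  selected (yes q) _ = q
  selected (no _)  ()

module Bookkeeping {n} (r : Fin n → ℚ) (apx : Subset n → ℚ → Subset n) where
  open Alg r apx

  Done⇒selected : ∀ {k j} → j ∈ Done k → ∃ λ m → m ℕ.< k × j ∈ S m
  Done⇒selected {zero}  j∈ = ⊥-elim (∉⊥ j∈)
  Done⇒selected {suc k} j∈ with x∈p∪q⁻ (Done k) (S k) j∈
  ... | inj₂ j∈S    = k , ℕP.n<1+n k , j∈S
  ... | inj₁ j∈Done with Done⇒selected j∈Done
  ...   | m , m<k , j∈S = m , ℕP.m<n⇒m<1+n m<k , j∈S

  R⇒released : ∀ {k j} → j ∈ R k → r j ≤ τ k
  R⇒released {k} j∈R = ∈-select⁻ (λ i → r i QP.≤? τ k) (proj₁ (x∈p∩q⁻ _ _ j∈R))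

  unscheduled⇒R∖S : ∀ {k j} → r j ≤ τ k → j ∉ Done (suc k) → j ∈ (R k ∖ S k)
  unscheduled⇒R∖S {k} released j∉ = x∈p∩q⁺
    ( x∈p∩q⁺ (∈-select⁺ (λ i → r i QP.≤? τ k) released , x∉p⇒x∈∁p (λ j∈ → j∉ (x∈p∪q⁺ (inj₁ j∈))))
    , x∉p⇒x∈∁p (λ j∈ → j∉ (x∈p∪q⁺ (inj₂ j∈))) )

module PhaseBound {n} {r : Fin n → ℚ} (E : Env n r) (w : Fin n → ℚ) (w≥0 : ∀ j → 0ℚ ≤ w j)
                  (apx : Subset n → ℚ → Subset n) (k : ℕ) where
  open Env E
  open Alg r apx
  open Bookkeeping r apx

  releasedLate : Fin n → Bool
  releasedLate j = does (τ k QP.<? r j)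

  U : ℚ
  U = sumℚ (λ j → ind (releasedLate j) (w j))

  U-nonneg : 0ℚ ≤ U
  U-nonneg = sum-nonneg (λ j → ind-nonneg (releasedLate j) (w≥0 j))

  earlyIn : Schedule → Subset n
  earlyIn σ = R k ∩ completedBy (C σ) (τ k)

  -- Every job A completes after α τ_{k+1} lies in R(τ_k) ∖ S_k or is released after τ_k.
  A-bound : ∀ {α CA} → 0ℚ ≤ α → IsAlgSchedule α CA
          → Wt w CA (α * τ (suc k)) ≤ wt w (R k ∖ S k) + U
  A-bound {α} {CA} α≥0 hCA = begin
    Wt w CA t                                                       ≤⟨ sum-mono cover ⟩
    sumℚ (λ j → ind (does (j ∈? (R k ∖ S k))) (w j) + ind (releasedLate j) (w j))
      ≡⟨ sum-+ (λ j → ind (does (j ∈? (R k ∖ S k))) (w j)) (λ j → ind (releasedLate j) (w j)) ⟩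
    wt w (R k ∖ S k) + U                                            ∎
    where
    open QP.≤-Reasoning
    t : ℚ
    t = α * τ (suc k)

    finished : ∀ j → j ∈ Done (suc k) → ¬ T (completesAfter (CA j) t)
    finished j j∈ with Done⇒selected j∈
    ... | m , m<k+1 , j∈S with proj₁ hCA m j j∈S
    ...   | c , CAj≡c , c≤ατ rewrite CAj≡c = λ t<c →
      QP.<-irrefl refl (QP.≤-<-trans (QP.≤-trans c≤ατ ατ-mono) (T-does⁻ (t QP.<? c) t<c))
      where
      ατ-mono : α * τ (suc m) ≤ t
      ατ-mono = QP.*-monoˡ-≤-nonNeg α {{nonNegative α≥0}} (τ-mono {suc m} {suc k} m<k+1)

    running⇒R∖S∨late : ∀ j → T (completesAfter (CA j) t)
                     → T (does (j ∈? (R k ∖ S k))) ⊎ T (releasedLate j)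
    running⇒R∖S∨late j running with r j QP.≤? τ k
    ... | yes released = inj₁ (T-does⁺ (j ∈? (R k ∖ S k))
                                 (unscheduled⇒R∖S {k} released (λ j∈ → finished j j∈ running)))
    ... | no ¬released = inj₂ (T-does⁺ (τ k QP.<? r j) (QP.≰⇒> ¬released))

    cover : ∀ j → ind (completesAfter (CA j) t) (w j)
                ≤ ind (does (j ∈? (R k ∖ S k))) (w j) + ind (releasedLate j) (w j)
    cover j = ind-cover _ _ _ (w≥0 j) (running⇒R∖S∨late j)

  -- The jobs σ completes by τ_k fit in the deadline D_k, so the MUWP guarantee applies.
  MUWP-bound : ∀ {α β} → IsMUWPApprox E w α β apx
             → ∀ σ → wt w (R k ∖ S k) ≤ β * wt w (R k ∖ earlyIn σ)
  MUWP-bound hA σ = proj₂ (proj₂ (hA (R k) (Dl k) (phase-pos k))) (earlyIn σ) early⊆R feasible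
    where
    early⊆R : earlyIn σ ⊆ R k
    early⊆R j∈ = proj₁ (x∈p∩q⁻ _ _ j∈)
    feasible : CanComplete (earlyIn σ) (Dl k)
    feasible = subset-closed (λ j∈ → proj₂ (x∈p∩q⁻ _ _ j∈))
                 (deadline-mono (τ≤phase k) (prefix-feasible σ (τ k) (τ-nonneg k)))

  -- Jobs of R(τ_k) ∖ earlyIn σ and jobs released after τ_k are disjoint,
  -- and σ completes all of them after τ_k.
  σ-bound : ∀ σ → wt w (R k ∖ earlyIn σ) + U ≤ Wt w (λ j → just (C σ j)) (τ k)
  σ-bound σ = begin
    wt w (R k ∖ earlyIn σ) + U
      ≡⟨ sum-+ (λ j → ind (missed j) (w j)) (λ j → ind (releasedLate j) (w j)) ⟨
    sumℚ (λ j → ind (missed j) (w j) + ind (releasedLate j) (w j))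
      ≤⟨ sum-mono (λ j → ind-disjoint (late j) (missed j) (releasedLate j) (w≥0 j)
                           (missed⇒late j) (releasedLate⇒late j) (disjoint j)) ⟩
    Wt w (λ j → just (C σ j)) (τ k) ∎
    where
    open QP.≤-Reasoning
    missed late : Fin n → Bool
    missed j = does (j ∈? (R k ∖ earlyIn σ))
    late j   = does (τ k QP.<? C σ j)

    missed⇒late : ∀ j → T (missed j) → T (late j)
    missed⇒late j m = T-does⁺ (τ k QP.<? C σ j) (QP.≰⇒> notEarly)
      where
      j∈ : j ∈ R k × j ∈ ∁ (earlyIn σ)
      j∈ = x∈p∩q⁻ (R k) _ (T-does⁻ (j ∈? _) m)
      notEarly : ¬ C σ j ≤ τ k
      notEarly C≤τ = x∈∁p⇒x∉p (proj₂ j∈) (x∈p∩q⁺ (proj₁ j∈ , ∈-select⁺ (λ i → C σ i QP.≤? τ k) C≤τ))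

    releasedLate⇒late : ∀ j → T (releasedLate j) → T (late j)
    releasedLate⇒late j l = T-does⁺ (τ k QP.<? C σ j)
      (QP.<-trans (T-does⁻ (τ k QP.<? r j) l) (QP.<-≤-trans (r<r+1 (r j)) (proc≥1 σ j)))
      where
      r<r+1 : ∀ p → p < p + 1ℚ
      r<r+1 p = subst (_< p + 1ℚ) (QP.+-identityʳ p) (QP.+-monoʳ-< p (QP.positive⁻¹ 1ℚ))

    disjoint : ∀ j → T (missed j) → T (releasedLate j) → ⊥
    disjoint j m l = QP.<-irrefl refl (QP.<-≤-trans (T-does⁻ (τ k QP.<? r j) l)
      (R⇒released {k} (proj₁ (x∈p∩q⁻ (R k) _ (T-does⁻ (j ∈? _) m)))))

  phase-bound : ∀ {α β CA} → 0ℚ ≤ α → 1ℚ ≤ β → IsMUWPApprox E w α β apx → IsAlgSchedule α CA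
              → ∀ σ → Wt w CA (α * τ (suc k)) ≤ β * Wt w (λ j → just (C σ j)) (τ k)
  phase-bound {α} {β} {CA} α≥0 1≤β hA hCA σ = begin
    Wt w CA (α * τ (suc k))                ≤⟨ A-bound α≥0 hCA ⟩
    wt w (R k ∖ S k) + U                   ≤⟨ absorb 1≤β U-nonneg (MUWP-bound {α} {β} hA σ) ⟩
    β * (wt w (R k ∖ earlyIn σ) + U)        ≤⟨ QP.*-monoˡ-≤-nonNeg β {{nonNegative β≥0}} (σ-bound σ) ⟩
    β * Wt w (λ j → just (C σ j)) (τ k)    ∎
    where
    open QP.≤-Reasoning
    β≥0 : 0ℚ ≤ β
    β≥0 = ≥1⇒nonneg 1≤β

-- Lemma 1: the phase bound against an optimal schedule.

lemma1 : ∀ {n} (w r : Fin n → ℚ) → (∀ j → 0ℚ ≤ w j) → (∀ j → 0ℚ ≤ r j)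
    → (E : Env n r) → (α β : ℚ) → 1ℚ ≤ α → 1ℚ ≤ β
    → (apx : Subset n → ℚ → Subset n) → IsMUWPApprox E w α β apx
    → (opt : Env.Schedule E) → IsOptimal E w opt
    → (CA : Fin n → Maybe ℚ) → Alg.IsAlgSchedule r apx α CA
    → ∀ (k : ℕ) → Wt w CA (α * τ (suc k)) ≤ β * Wt w (λ j → just (Env.C E opt j)) (τ k)
lemma1 w r w≥0 _ E α β 1≤α 1≤β apx hA opt _ CA hCA k =
  PhaseBound.phase-bound E w w≥0 apx k (≥1⇒nonneg 1≤α) 1≤β hA hCA opt
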